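{- Let $P$ and $Q$ be finite strings of binary digits (each possibly empty, $P$ either empty or beginning with $1$), and suppose the binary expansion of $n$ is the concatenation $P\,111\,Q$. Let $m_1$, $m_2$, $m_3$ be the nonnegative integers whose binary representations (read as numerals, the empty string denoting $0$) are $P\,11\,Q$, $P\,1\,Q$ and $P\,Q$ respectively. Equivalently, if $Q$ has length $t\geq0$ and value $\alpha<2^t$ and $P$ has value $\beta\geq0$, then $n=\alpha+7\cdot2^t+\beta2^{t+3}$, $m_1=\alpha+3\cdot2^t+\beta2^{t+2}$, $m_2=\alpha+2^t+\beta2^{t+1}$, $m_3=\alpha+\beta2^t$. Then \[ |H_8^{\nabla n}|=7\cdot|H_8^{\nabla m_1}|-2\cdot|H_8^{\nabla m_2}|-24\cdot|H_8^{\nabla m_3}|. \]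
   Context: For nonempty finite sets $C=\{c_1,\ldots,c_s\}$, $D$ of positive integers, $C\mathbin{\nabla}D=c_1D\mathbin{\triangle}\cdots\mathbin{\triangle}c_sD$, where $c_iD=\{c_id:d\in D\}$ and $\triangle$ is symmetric difference. Let $H_8=\{1,2,\ldots,8\}$, $H_8^{\nabla0}=\{1\}$ and $H_8^{\nabla k}=H_8^{\nabla(k-1)}\mathbin{\nabla}H_8$ for $k\geq1$. -}

module Defs where

open import Data.Nat using (ℕ; suc; _*_; _≟_)
open import Data.List using (List; []; _∷_; map; filter; foldr; _++_; length; deduplicate; upTo)
open import Data.List.Membership.DecPropositional _≟_ using (_∉?_)

-- Finite sets of positive integers are represented by lists (membership
-- semantics: x ∈ S iff x occurs in the list). Cardinality counts distinct elements.

_△_ : List ℕ → List ℕ → List ℕ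
A △ B = filter (_∉? B) A ++ filter (_∉? A) B

_·_ : ℕ → List ℕ → List ℕ
c · D = map (c *_) D

_∇_ : List ℕ → List ℕ → List ℕ
C ∇ D = foldr (λ c acc → (c · D) △ acc) [] C

card : List ℕ → ℕ
card S = length (deduplicate _≟_ S)

H8 : List ℕ
H8 = map suc (upTo 8)

H8^∇ : ℕ → List ℕ
H8^∇ 0 = 1 ∷ []
H8^∇ (suc k) = H8^∇ k ∇ H8

{-# OPTIONS --safe #-}

-- Writing n = 2ᵃ 3ᵇ 5ᶜ 7ᵈ as the monomial x₁ᵃ x₂ᵇ x₃ᶜ x₄ᵈ turns a finite set of 7-smooth numbers into
-- a polynomial over 𝔽₂: dilation becomes multiplication by a monomial and △ becomes addition.  Hence
-- |H₈^∇ⁿ| is the number of monomials of Pⁿ, where P = 1 + x₁ + x₂ + x₁² + x₃ + x₁x₂ + x₄ + x₁³.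
--
-- By Frobenius, P^(2m+b) · T = P(x²)ᵐ · (Pᵇ T).  Sorting the monomials of Pᵇ T by the parities r of
-- their exponents, Pᵇ T = Σ_r xʳ T_r(x²), so the number of monomials of P^(2m+b) T is Σ_r of that of
-- Pᵐ T_r.  For T ∈ {1, 1 + x₁, 1 + x₁²} every T_r is again 0 or one of these three polynomials, so the
-- three counts c(m) satisfy c(2m + b) = M_b c(m) for explicit 3 × 3 matrices M₀, M₁.  The identity to
-- be proved is linear in c, so appending the digits of Q preserves it; for empty Q it is the
-- Cayley–Hamilton theorem for M₁, whose characteristic polynomial is X³ − 7X² + 2X + 24.

module Submission where

open import Defs using (card; H8; H8^∇)

open import Algebra.Bundles using (CommutativeRing; CommutativeMonoid)
import Algebra.Properties.CommutativeSemigroup as CommSemigroupProperties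
open import Data.Bool using (Bool; true; false; not; _∧_; _∨_; _xor_; if_then_else_)
import Data.Bool.Properties as Bool
open import Data.Bool.Properties
  using ( xor-assoc; xor-comm; xor-same; xor-identityʳ; xor-∧-commutativeRing; ∧-distribˡ-xor
        ; ∧-assoc; ∧-zeroʳ; ∧-distribˡ-∨; ∧-commutativeMonoid; ∨-identityʳ )
open import Data.Integer as ℤ using (+_)
import Data.Integer.Properties as ℤ
import Data.Integer.Tactic.RingSolver as ℤSolver
import Data.List as List
open import Data.List using (List; []; _∷_; _++_; map; filter; foldr; cartesianProductWith; length; deduplicate)
open import Data.List.Properties using (length-map; map-++; ≡-dec)
open import Data.List.Membership.Propositional.Properties
  using (∈-filter⁺; ∈-filter⁻; ++-∈⇔; ∈-map⁺; ∈-map⁻; deduplicate-∈⇔)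
open import Data.List.Membership.Propositional.Properties.WithK using (unique∧set⇒bag)
open import Data.List.Relation.Binary.BagAndSetEquality using (∼bag⇒↭)
open import Data.List.Relation.Binary.Permutation.Propositional.Properties using (↭-length)
open import Data.List.Relation.Unary.All using ([])
open import Data.List.Relation.Unary.All.Properties using (All¬⇒¬Any)
open import Data.List.Relation.Unary.AllPairs using ([]; _∷_)
open import Data.List.Relation.Unary.Any using (Any; here; there; any?)
open import Data.List.Relation.Unary.Unique.Propositional using (Unique)
import Data.List.Relation.Unary.Unique.Propositional.Properties as Unique
open import Data.List.Relation.Unary.Unique.DecPropositional using (unique?)
import Data.List.Relation.Unary.Unique.DecPropositional.Properties as DecUnique
open import Data.Nat using (ℕ; zero; suc; s≤s; _≤_; _<_; _^_; _+_; _*_; _∸_; _≡ᵇ_; _≤ᵇ_; _<ᵇ_; ⌊_/2⌋)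
import Data.Nat.Properties as ℕ
open import Data.Nat.Divisibility using (_∣_; _∣?_; ∣1⇒≡1; m∣m*n)
open import Data.Nat.Primality using (Prime; prime?; prime[2]; euclidsLemma; ¬prime[1]; prime⇒nonZero)
open import Data.Nat.Tactic.RingSolver using (solve-∀; solve)
open import Data.Product using (_×_; _,_; proj₁; proj₂)
open import Data.Sum using (inj₁; inj₂)
import Data.Vec as V
open import Data.Vec using (Vec; []; _∷_; zipWith; replicate)
import Data.Vec.Properties as Vec
open import Function using (_∘_)
open import Function.Bundles using (mk⇔)
open import Relation.Binary.Definitions using (DecidableEquality)
open import Relation.Binary.PropositionalEquality
  using (_≡_; refl; sym; trans; cong; cong₂; subst; _≗_; module ≡-Reasoning)
open import Relation.Nullary using (Dec; does; yes; no; ¬_; _×-dec_; _⊎-dec_; contradiction)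
open import Relation.Nullary.Decidable using (does-⇔; dec-true; dec-false; from-yes; from-no; map′)
open import Relation.Unary using (Decidable)

private
  variable
    A B C : Set
    k : ℕ

module And where
  open CommSemigroupProperties (CommutativeMonoid.commutativeSemigroup ∧-commutativeMonoid)
    public using (interchange)

module Plus where
  open CommSemigroupProperties ℕ.+-commutativeSemigroup public using (interchange)

module Xor where
  open CommSemigroupProperties
    (CommutativeMonoid.commutativeSemigroup (CommutativeRing.+-commutativeMonoid xor-∧-commutativeRing))
    public using (interchange)

does-∧-cong : ∀ {P : Set} (P? : Dec P) {x y} → (P → x ≡ y) → (does P? ∧ x) ≡ (does P? ∧ y)
does-∧-cong (yes p) x≡y = x≡y p
does-∧-cong (no ¬p) x≡y = refl

-- Sums in 𝔽₂

⨁ : (A → Bool) → List A → Bool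
⨁ φ []       = false
⨁ φ (x ∷ xs) = φ x xor ⨁ φ xs

⨁-cong : {φ ψ : A → Bool} → φ ≗ ψ → ∀ xs → ⨁ φ xs ≡ ⨁ ψ xs
⨁-cong φ≗ψ []       = refl
⨁-cong φ≗ψ (x ∷ xs) = cong₂ _xor_ (φ≗ψ x) (⨁-cong φ≗ψ xs)

⨁-false : ∀ (xs : List A) → ⨁ (λ _ → false) xs ≡ false
⨁-false []       = refl
⨁-false (x ∷ xs) = ⨁-false xs

⨁-++ : ∀ (φ : A → Bool) xs ys → ⨁ φ (xs ++ ys) ≡ ⨁ φ xs xor ⨁ φ ys
⨁-++ φ []       ys = refl
⨁-++ φ (x ∷ xs) ys = trans (cong (φ x xor_) (⨁-++ φ xs ys)) (sym (xor-assoc (φ x) _ _))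

⨁-map : ∀ (φ : B → Bool) (f : A → B) xs → ⨁ φ (map f xs) ≡ ⨁ (φ ∘ f) xs
⨁-map φ f []       = refl
⨁-map φ f (x ∷ xs) = cong (φ (f x) xor_) (⨁-map φ f xs)

⨁-∧ˡ : ∀ b (φ : A → Bool) xs → ⨁ (λ x → b ∧ φ x) xs ≡ b ∧ ⨁ φ xs
⨁-∧ˡ b φ []       = sym (∧-zeroʳ b)
⨁-∧ˡ b φ (x ∷ xs) = trans (cong ((b ∧ φ x) xor_) (⨁-∧ˡ b φ xs)) (sym (∧-distribˡ-xor b (φ x) _))

⨁-filter : ∀ (φ : A → Bool) {P : A → Set} (P? : Decidable P) xs →
           ⨁ φ (filter P? xs) ≡ ⨁ (λ x → does (P? x) ∧ φ x) xs
⨁-filter φ P? []       = refl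
⨁-filter φ P? (x ∷ xs) with does (P? x)
... | true  = cong (φ x xor_) (⨁-filter φ P? xs)
... | false = ⨁-filter φ P? xs

⨁-xor : ∀ (φ ψ : A → Bool) xs → ⨁ (λ x → φ x xor ψ x) xs ≡ ⨁ φ xs xor ⨁ ψ xs
⨁-xor φ ψ []       = refl
⨁-xor φ ψ (x ∷ xs) =
  trans (cong ((φ x xor ψ x) xor_) (⨁-xor φ ψ xs)) (Xor.interchange (φ x) (ψ x) _ _)

⨁-cartesianProductWith : ∀ (φ : A → Bool) (f : B → C → A) xs ys →
  ⨁ φ (cartesianProductWith f xs ys) ≡ ⨁ (λ x → ⨁ (φ ∘ f x) ys) xs
⨁-cartesianProductWith φ f []       ys = refl
⨁-cartesianProductWith φ f (x ∷ xs) ys = begin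
  ⨁ φ (map (f x) ys ++ cartesianProductWith f xs ys)
    ≡⟨ ⨁-++ φ (map (f x) ys) _ ⟩
  ⨁ φ (map (f x) ys) xor ⨁ φ (cartesianProductWith f xs ys)
    ≡⟨ cong₂ _xor_ (⨁-map φ (f x) ys) (⨁-cartesianProductWith φ f xs ys) ⟩
  ⨁ (φ ∘ f x) ys xor ⨁ (λ x′ → ⨁ (φ ∘ f x′) ys) xs ∎
  where open ≡-Reasoning

⨁-comm : ∀ (φ : A → B → Bool) xs ys →
         ⨁ (λ x → ⨁ (φ x) ys) xs ≡ ⨁ (λ y → ⨁ (λ x → φ x y) xs) ys
⨁-comm φ []       ys = sym (⨁-false ys)
⨁-comm φ (x ∷ xs) ys =
  trans (cong (⨁ (φ x) ys xor_) (⨁-comm φ xs ys)) (sym (⨁-xor (φ x) _ ys))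

-- In characteristic 2 the off-diagonal terms of a symmetric double sum cancel in pairs.
⨁-diagonal : ∀ (φ : A → A → Bool) → (∀ x y → φ x y ≡ φ y x) → ∀ xs →
             ⨁ (λ x → ⨁ (φ x) xs) xs ≡ ⨁ (λ x → φ x x) xs
⨁-diagonal φ sym-φ []       = refl
⨁-diagonal φ sym-φ (y ∷ ys) = begin
  (φ y y xor ⨁ (φ y) ys) xor ⨁ (λ x → φ x y xor ⨁ (φ x) ys) ys
    ≡⟨ cong ((φ y y xor ⨁ (φ y) ys) xor_) (⨁-xor (λ x → φ x y) _ ys) ⟩
  (φ y y xor ⨁ (φ y) ys) xor (⨁ (λ x → φ x y) ys xor ⨁ (λ x → ⨁ (φ x) ys) ys)
    ≡⟨ cong₂ (λ b c → (φ y y xor ⨁ (φ y) ys) xor (b xor c))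
             (⨁-cong (λ x → sym-φ x y) ys) (⨁-diagonal φ sym-φ ys) ⟩
  (φ y y xor ⨁ (φ y) ys) xor (⨁ (φ y) ys xor ⨁ (λ x → φ x x) ys)
    ≡⟨ cancel (φ y y) (⨁ (φ y) ys) _ ⟩
  φ y y xor ⨁ (λ x → φ x x) ys ∎
  where
  open ≡-Reasoning
  cancel : ∀ a b c → (a xor b) xor (b xor c) ≡ a xor c
  cancel a b c = begin
    (a xor b) xor (b xor c) ≡⟨ xor-assoc a b _ ⟩
    a xor (b xor (b xor c)) ≡⟨ cong (a xor_) (sym (xor-assoc b b c)) ⟩
    a xor ((b xor b) xor c) ≡⟨ cong (λ d → a xor (d xor c)) (xor-same b) ⟩
    a xor c                 ∎

module Membership (_≟_ : DecidableEquality A) where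

  open import Data.List.Membership.DecPropositional _≟_ public using (_∈_; _∈?_; _∉?_)

  infix 7 _∈ᵇ_

  _∈ᵇ_ : A → List A → Bool
  x ∈ᵇ xs = does (x ∈? xs)

  ∈ᵇ⇒∈ : ∀ {x xs} → x ∈ᵇ xs ≡ true → x ∈ xs
  ∈ᵇ⇒∈ {x} {xs} eq with x ∈? xs | eq
  ... | yes x∈xs | _ = x∈xs

  ∈ᵇ-++ : ∀ x xs ys → x ∈ᵇ (xs ++ ys) ≡ (x ∈ᵇ xs ∨ x ∈ᵇ ys)
  ∈ᵇ-++ x xs ys = does-⇔ ++-∈⇔ (x ∈? (xs ++ ys)) (x ∈? xs ⊎-dec x ∈? ys)

  ∈ᵇ-filter : ∀ {P : A → Set} (P? : Decidable P) x xs → x ∈ᵇ (filter P? xs) ≡ (does (P? x) ∧ x ∈ᵇ xs)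
  ∈ᵇ-filter P? x xs = does-⇔
    (mk⇔ (λ p → let q = ∈-filter⁻ P? p in proj₂ q , proj₁ q) (λ (Px , x∈xs) → ∈-filter⁺ P? x∈xs Px))
    (x ∈? filter P? xs) (P? x ×-dec x ∈? xs)

  ∈ᵇ-map : ∀ (f : A → A) x g h → (∀ y → does (x ≟ f y) ≡ (g ∧ does (h ≟ y))) →
           ∀ ys → x ∈ᵇ (map f ys) ≡ (g ∧ h ∈ᵇ ys)
  ∈ᵇ-map f x g h x≟f[y] []       = sym (∧-zeroʳ g)
  ∈ᵇ-map f x g h x≟f[y] (y ∷ ys) = trans (cong₂ _∨_ (x≟f[y] y) (∈ᵇ-map f x g h x≟f[y] ys))
                                         (sym (∧-distribˡ-∨ g _ _))

  ∈ᵇ-unique : ∀ x {xs} → Unique xs → x ∈ᵇ xs ≡ ⨁ (λ y → does (x ≟ y)) xs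
  ∈ᵇ-unique x {[]}     []             = refl
  ∈ᵇ-unique x {y ∷ ys} (y∉ys ∷ uys) with x ≟ y
  ... | yes refl = cong not (sym (trans (sym (∈ᵇ-unique x uys)) (dec-false (x ∈? ys) (All¬⇒¬Any y∉ys))))
  ... | no  _    = ∈ᵇ-unique x uys

  length-≗ : ∀ {xs ys} → Unique xs → Unique ys → (∀ x → x ∈ᵇ xs ≡ x ∈ᵇ ys) → length xs ≡ length ys
  length-≗ {xs} {ys} uxs uys same = ↭-length (∼bag⇒↭ (unique∧set⇒bag uxs uys (mk⇔ to from)))
    where
    to : ∀ {x} → x ∈ xs → x ∈ ys
    to {x} x∈xs = ∈ᵇ⇒∈ (trans (sym (same x)) (dec-true (x ∈? xs) x∈xs))
    from : ∀ {x} → x ∈ ys → x ∈ xs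
    from {x} x∈ys = ∈ᵇ⇒∈ (trans (same x) (dec-true (x ∈? ys) x∈ys))

  length-deduplicate-unique : ∀ {xs} → Unique xs → length (deduplicate _≟_ xs) ≡ length xs
  length-deduplicate-unique {xs} uxs = length-≗ (DecUnique.deduplicate-! _≟_ xs) uxs
    (λ x → sym (does-⇔ (deduplicate-∈⇔ _≟_) (x ∈? xs) (x ∈? deduplicate _≟_ xs)))

-- The operations of Defs for any binary operation on a type with decidable equality; for (ℕ, _*_)
-- they unfold to Defs' own.
module SetConvolution (_≟_ : DecidableEquality A) (_∙_ : A → A → A) where

  open Membership _≟_

  infixr 5 _△_

  _△_ : List A → List A → List A
  xs △ ys = filter (_∉? ys) xs ++ filter (_∉? xs) ys

  _·_ : A → List A → List A
  c · ys = map (c ∙_) ys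

  _∇_ : List A → List A → List A
  cs ∇ ys = foldr (λ c acc → (c · ys) △ acc) [] cs

  ∈ᵇ-△ : ∀ x xs ys → x ∈ᵇ (xs △ ys) ≡ (x ∈ᵇ xs xor x ∈ᵇ ys)
  ∈ᵇ-△ x xs ys = begin
    x ∈ᵇ (filter (_∉? ys) xs ++ filter (_∉? xs) ys)
      ≡⟨ ∈ᵇ-++ x (filter (_∉? ys) xs) (filter (_∉? xs) ys) ⟩
    x ∈ᵇ (filter (_∉? ys) xs) ∨ x ∈ᵇ (filter (_∉? xs) ys)
      ≡⟨ cong₂ _∨_ (∈ᵇ-filter (_∉? ys) x xs) (∈ᵇ-filter (_∉? xs) x ys) ⟩
    (not (x ∈ᵇ ys) ∧ x ∈ᵇ xs) ∨ (not (x ∈ᵇ xs) ∧ x ∈ᵇ ys)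
      ≡⟨ or-of-differences (x ∈ᵇ xs) (x ∈ᵇ ys) ⟩
    x ∈ᵇ xs xor x ∈ᵇ ys ∎
    where
    open ≡-Reasoning
    or-of-differences : ∀ a b → (not b ∧ a) ∨ (not a ∧ b) ≡ a xor b
    or-of-differences false false = refl
    or-of-differences false true  = refl
    or-of-differences true  false = refl
    or-of-differences true  true  = refl

  △-unique : ∀ {xs ys} → Unique xs → Unique ys → Unique (xs △ ys)
  △-unique {xs} {ys} uxs uys = Unique.++⁺ (Unique.filter⁺ (_∉? ys) uxs) (Unique.filter⁺ (_∉? xs) uys) disjoint
    where
    disjoint : ∀ {v} → ¬ (v ∈ filter (_∉? ys) xs × v ∈ filter (_∉? xs) ys)
    disjoint (p , q) = proj₂ (∈-filter⁻ (_∉? ys) {xs = xs} p) (proj₁ (∈-filter⁻ (_∉? xs) {xs = ys} q))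

  ∇-unique : (∀ c {x y} → c ∙ x ≡ c ∙ y → x ≡ y) → ∀ cs {ys} → Unique ys → Unique (cs ∇ ys)
  ∇-unique cancel []       uys = []
  ∇-unique cancel (c ∷ cs) uys = △-unique (Unique.map⁺ (cancel c) uys) (∇-unique cancel cs uys)

≤ᵇ-suc : ∀ m n → (suc m ≤ᵇ suc n) ≡ (m ≤ᵇ n)
≤ᵇ-suc zero    n = refl
≤ᵇ-suc (suc m) n = refl

≡ᵇ-+ : ∀ e c d → (e ≡ᵇ c + d) ≡ ((c ≤ᵇ e) ∧ (e ∸ c ≡ᵇ d))
≡ᵇ-+ e       zero    d = refl
≡ᵇ-+ zero    (suc c) d = refl
≡ᵇ-+ (suc e) (suc c) d = trans (≡ᵇ-+ e c d) (cong (_∧ (e ∸ c ≡ᵇ d)) (sym (≤ᵇ-suc c e)))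

≤ᵇ-+ : ∀ e a b → ((a ≤ᵇ e) ∧ (b ≤ᵇ e ∸ a)) ≡ (a + b ≤ᵇ e)
≤ᵇ-+ e       zero    b = refl
≤ᵇ-+ zero    (suc a) b = refl
≤ᵇ-+ (suc e) (suc a) b = begin
  (suc a ≤ᵇ suc e) ∧ (b ≤ᵇ e ∸ a) ≡⟨ cong (_∧ (b ≤ᵇ e ∸ a)) (≤ᵇ-suc a e) ⟩
  (a ≤ᵇ e) ∧ (b ≤ᵇ e ∸ a)         ≡⟨ ≤ᵇ-+ e a b ⟩
  a + b ≤ᵇ e                      ≡⟨ sym (≤ᵇ-suc (a + b) e) ⟩
  suc (a + b) ≤ᵇ suc e            ∎
  where open ≡-Reasoning

odd : ℕ → Bool
odd zero          = false
odd (suc zero)    = true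
odd (suc (suc n)) = odd n

bit : Bool → ℕ
bit false = 0
bit true  = 1

pushBit : Bool → ℕ → ℕ
pushBit b zero    = bit b
pushBit b (suc q) = suc (suc (pushBit b q))

odd-pushBit : ∀ b q → odd (pushBit b q) ≡ b
odd-pushBit false zero    = refl
odd-pushBit true  zero    = refl
odd-pushBit b     (suc q) = odd-pushBit b q

odd-suc-pushBit : ∀ b q → odd (suc (pushBit b q)) ≡ not b
odd-suc-pushBit false zero    = refl
odd-suc-pushBit true  zero    = refl
odd-suc-pushBit b     (suc q) = odd-suc-pushBit b q

half-pushBit : ∀ b q → ⌊ pushBit b q /2⌋ ≡ q
half-pushBit false zero    = refl
half-pushBit true  zero    = refl
half-pushBit b     (suc q) = cong suc (half-pushBit b q)

pushBit-odd-half : ∀ e → pushBit (odd e) ⌊ e /2⌋ ≡ e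
pushBit-odd-half zero          = refl
pushBit-odd-half (suc zero)    = refl
pushBit-odd-half (suc (suc e)) = cong (suc ∘ suc) (pushBit-odd-half e)

pushBit-true : ∀ q → pushBit true q ≡ suc (pushBit false q)
pushBit-true zero    = refl
pushBit-true (suc q) = cong (suc ∘ suc) (pushBit-true q)

pushBit-false : ∀ q → pushBit false q ≡ q + q
pushBit-false zero    = refl
pushBit-false (suc q) = cong suc (trans (cong suc (pushBit-false q)) (sym (ℕ.+-suc q q)))

≤ᵇ-pushBit : ∀ b q w →
  ((w ≤ᵇ pushBit b q) ∧ does (odd (pushBit b q ∸ w) Bool.≟ false)) ≡ (does (odd w Bool.≟ b) ∧ (⌊ w /2⌋ ≤ᵇ q))
≤ᵇ-pushBit b q zero rewrite odd-pushBit b q with b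
... | false = refl
... | true  = refl
≤ᵇ-pushBit false zero    (suc zero) = refl
≤ᵇ-pushBit true  zero    (suc zero) = refl
≤ᵇ-pushBit b     (suc q) (suc zero) rewrite odd-suc-pushBit b q with b
... | false = refl
... | true  = refl
≤ᵇ-pushBit false zero    (suc (suc w)) = sym (∧-zeroʳ _)
≤ᵇ-pushBit true  zero    (suc (suc w)) = sym (∧-zeroʳ _)
≤ᵇ-pushBit b     (suc q) (suc (suc w)) = begin
  (suc (suc w) ≤ᵇ suc (suc e)) ∧ does (odd (e ∸ w) Bool.≟ false)
    ≡⟨ cong (_∧ does (odd (e ∸ w) Bool.≟ false)) (trans (≤ᵇ-suc (suc w) (suc e)) (≤ᵇ-suc w e)) ⟩
  (w ≤ᵇ e) ∧ does (odd (e ∸ w) Bool.≟ false)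
    ≡⟨ ≤ᵇ-pushBit b q w ⟩
  does (odd w Bool.≟ b) ∧ (⌊ w /2⌋ ≤ᵇ q)
    ≡⟨ cong (does (odd w Bool.≟ b) ∧_) (sym (≤ᵇ-suc ⌊ w /2⌋ q)) ⟩
  does (odd w Bool.≟ b) ∧ (suc ⌊ w /2⌋ ≤ᵇ suc q) ∎
  where
  open ≡-Reasoning
  e = pushBit b q

half-pushBit-∸ : ∀ b q w → odd w ≡ b → ⌊ pushBit b q ∸ w /2⌋ ≡ q ∸ ⌊ w /2⌋
half-pushBit-∸ b     q       zero          _    = half-pushBit b q
half-pushBit-∸ true  zero    (suc zero)    _    = refl
half-pushBit-∸ true  (suc q) (suc zero)    _    =
  trans (cong (⌊_/2⌋ ∘ suc) (pushBit-true q)) (half-pushBit false (suc q))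
half-pushBit-∸ false zero    (suc (suc w)) _    = refl
half-pushBit-∸ true  zero    (suc (suc w)) _    = refl
half-pushBit-∸ b     (suc q) (suc (suc w)) odd≡ = half-pushBit-∸ b q w odd≡

-- Monomials

-- A monomial is its exponent vector: ⊕ multiplies, w ≼ e says that xʷ divides xᵉ, and
-- unsplit r q = r + 2q is the exponent vector with parities r and halves q.
Monomial : ℕ → Set
Monomial = Vec ℕ

infixl 8 _⊕_ _⊖_
infix  7 _≼_
infix  4 _≟ᵐ_ _≟ᵖ_

_⊕_ _⊖_ : Monomial k → Monomial k → Monomial k
_⊕_ = zipWith _+_
_⊖_ = zipWith _∸_

_≼_ : Monomial k → Monomial k → Bool
[]       ≼ []       = true
(w ∷ ws) ≼ (e ∷ es) = (w ≤ᵇ e) ∧ (ws ≼ es)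

𝟎 : Monomial k
𝟎 = replicate _ 0

parity : Monomial k → Vec Bool k
parity = V.map odd

half : Monomial k → Monomial k
half = V.map ⌊_/2⌋

allEven : Vec Bool k
allEven = replicate _ false

unsplit : Vec Bool k → Monomial k → Monomial k
unsplit = zipWith pushBit

_≟ᵐ_ : DecidableEquality (Monomial k)
_≟ᵐ_ = Vec.≡-dec ℕ._≟_

_≟ᵖ_ : DecidableEquality (Vec Bool k)
_≟ᵖ_ = Vec.≡-dec Bool._≟_

≟-⊕ : ∀ (e c d : Monomial k) → does (e ≟ᵐ c ⊕ d) ≡ ((c ≼ e) ∧ does (e ⊖ c ≟ᵐ d))
≟-⊕ []       []       []       = refl
≟-⊕ (e ∷ es) (c ∷ cs) (d ∷ ds) =
  trans (cong₂ _∧_ (≡ᵇ-+ e c d) (≟-⊕ es cs ds)) (And.interchange (c ≤ᵇ e) _ _ _)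

≼-⊕ : ∀ (e a b : Monomial k) → ((a ≼ e) ∧ (b ≼ e ⊖ a)) ≡ (a ⊕ b ≼ e)
≼-⊕ []       []       []       = refl
≼-⊕ (e ∷ es) (a ∷ as) (b ∷ bs) =
  trans (And.interchange (a ≤ᵇ e) _ _ _) (cong₂ _∧_ (≤ᵇ-+ e a b) (≼-⊕ es as bs))

⊖-⊕ : ∀ (e a b : Monomial k) → e ⊖ a ⊖ b ≡ e ⊖ (a ⊕ b)
⊖-⊕ []       []       []       = refl
⊖-⊕ (e ∷ es) (a ∷ as) (b ∷ bs) = cong₂ _∷_ (ℕ.∸-+-assoc e a b) (⊖-⊕ es as bs)

⊕-comm : ∀ (a b : Monomial k) → a ⊕ b ≡ b ⊕ a
⊕-comm = Vec.zipWith-comm ℕ.+-comm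

⊕-cancelˡ : ∀ (c : Monomial k) {x y} → c ⊕ x ≡ c ⊕ y → x ≡ y
⊕-cancelˡ []       {[]}     {[]}     _  = refl
⊕-cancelˡ (c ∷ cs) {x ∷ xs} {y ∷ ys} eq =
  cong₂ _∷_ (ℕ.+-cancelˡ-≡ c x y (Vec.∷-injectiveˡ eq)) (⊕-cancelˡ cs (Vec.∷-injectiveʳ eq))

𝟎-≼ : ∀ (e : Monomial k) → 𝟎 ≼ e ≡ true
𝟎-≼ []       = refl
𝟎-≼ (e ∷ es) = 𝟎-≼ es

⊖-𝟎 : ∀ (e : Monomial k) → e ⊖ 𝟎 ≡ e
⊖-𝟎 []       = refl
⊖-𝟎 (e ∷ es) = cong (e ∷_) (⊖-𝟎 es)

parity-unsplit : ∀ (r : Vec Bool k) q → parity (unsplit r q) ≡ r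
parity-unsplit []       []       = refl
parity-unsplit (b ∷ r) (x ∷ q) = cong₂ _∷_ (odd-pushBit b x) (parity-unsplit r q)

half-unsplit : ∀ (r : Vec Bool k) q → half (unsplit r q) ≡ q
half-unsplit []      []      = refl
half-unsplit (b ∷ r) (x ∷ q) = cong₂ _∷_ (half-pushBit b x) (half-unsplit r q)

unsplit-parity-half : ∀ (e : Monomial k) → unsplit (parity e) (half e) ≡ e
unsplit-parity-half []       = refl
unsplit-parity-half (x ∷ e) = cong₂ _∷_ (pushBit-odd-half x) (unsplit-parity-half e)

unsplit-allEven : ∀ (w : Monomial k) → unsplit allEven w ≡ w ⊕ w
unsplit-allEven []       = refl
unsplit-allEven (x ∷ w) = cong₂ _∷_ (pushBit-false x) (unsplit-allEven w)

≟-unsplit : ∀ (e : Monomial k) r q → does (e ≟ᵐ unsplit r q) ≡ (does (parity e ≟ᵖ r) ∧ does (half e ≟ᵐ q))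
≟-unsplit e r q = does-⇔ (mk⇔ to from) (e ≟ᵐ unsplit r q) (parity e ≟ᵖ r ×-dec half e ≟ᵐ q)
  where
  to : e ≡ unsplit r q → parity e ≡ r × half e ≡ q
  to refl = parity-unsplit r q , half-unsplit r q
  from : parity e ≡ r × half e ≡ q → e ≡ unsplit r q
  from (refl , refl) = sym (unsplit-parity-half e)

≼-unsplit : ∀ (r : Vec Bool k) q w →
  ((w ≼ unsplit r q) ∧ does (parity (unsplit r q ⊖ w) ≟ᵖ allEven)) ≡ (does (parity w ≟ᵖ r) ∧ (half w ≼ q))
≼-unsplit []      []      []      = refl
≼-unsplit (b ∷ r) (x ∷ q) (y ∷ w) =
  trans (And.interchange (y ≤ᵇ pushBit b x) _ _ _)
        (trans (cong₂ _∧_ (≤ᵇ-pushBit b x y) (≼-unsplit r q w)) (And.interchange (does (odd y Bool.≟ b)) _ _ _))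

half-unsplit-⊖ : ∀ (r : Vec Bool k) q w → parity w ≡ r → half (unsplit r q ⊖ w) ≡ q ⊖ half w
half-unsplit-⊖ []      []      []      _  = refl
half-unsplit-⊖ (b ∷ r) (x ∷ q) (y ∷ w) eq =
  cong₂ _∷_ (half-pushBit-∸ b x y (Vec.∷-injectiveˡ eq)) (half-unsplit-⊖ r q w (Vec.∷-injectiveʳ eq))

-- Polynomials over 𝔽₂

-- A polynomial over 𝔽₂ is given by its coefficient function; f ⊛ ws is its product with Σ_{w ∈ ws} xʷ.
infixl 6 _⊛_

_⊛_ : (Monomial k → Bool) → List (Monomial k) → Monomial k → Bool
(f ⊛ ws) e = ⨁ (λ w → (w ≼ e) ∧ f (e ⊖ w)) ws

_⊗_ : List (Monomial k) → List (Monomial k) → List (Monomial k)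
_⊗_ = cartesianProductWith _⊕_

-- atSquares g and squares ws are the polynomials g(x₁², …, x_k²) and ws(x₁², …, x_k²).
atSquares : (Monomial k → Bool) → Monomial k → Bool
atSquares g e = does (parity e ≟ᵖ allEven) ∧ g (half e)

squares : List (Monomial k) → List (Monomial k)
squares = map (unsplit allEven)

-- ws = Σ_r xʳ · (parityPart r ws)(x₁², …, x_k²), summed over the parity vectors r.
parityPart : Vec Bool k → List (Monomial k) → List (Monomial k)
parityPart r ws = map half (filter (λ w → parity w ≟ᵖ r) ws)

⊛-cong : ∀ {f g : Monomial k → Bool} → f ≗ g → ∀ ws → (f ⊛ ws) ≗ (g ⊛ ws)
⊛-cong f≗g ws e = ⨁-cong (λ w → cong ((w ≼ e) ∧_) (f≗g (e ⊖ w))) ws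

⊛-⊛ : ∀ (f : Monomial k → Bool) us ws → (f ⊛ us ⊛ ws) ≗ (f ⊛ (ws ⊗ us))
⊛-⊛ f us ws e = begin
  ⨁ (λ w → (w ≼ e) ∧ ⨁ (λ u → (u ≼ e ⊖ w) ∧ f (e ⊖ w ⊖ u)) us) ws
    ≡⟨ ⨁-cong (λ w → sym (⨁-∧ˡ (w ≼ e) _ us)) ws ⟩
  ⨁ (λ w → ⨁ (λ u → (w ≼ e) ∧ ((u ≼ e ⊖ w) ∧ f (e ⊖ w ⊖ u))) us) ws
    ≡⟨ ⨁-cong (λ w → ⨁-cong (term w) us) ws ⟩
  ⨁ (λ w → ⨁ (λ u → φ (w ⊕ u)) us) ws
    ≡⟨ sym (⨁-cartesianProductWith φ _⊕_ ws us) ⟩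
  (f ⊛ (ws ⊗ us)) e ∎
  where
  open ≡-Reasoning
  φ : Monomial _ → Bool
  φ v = (v ≼ e) ∧ f (e ⊖ v)
  term : ∀ w u → ((w ≼ e) ∧ ((u ≼ e ⊖ w) ∧ f (e ⊖ w ⊖ u))) ≡ φ (w ⊕ u)
  term w u = begin
    (w ≼ e) ∧ ((u ≼ e ⊖ w) ∧ f (e ⊖ w ⊖ u)) ≡⟨ sym (∧-assoc (w ≼ e) _ _) ⟩
    ((w ≼ e) ∧ (u ≼ e ⊖ w)) ∧ f (e ⊖ w ⊖ u) ≡⟨ cong₂ _∧_ (≼-⊕ e w u) (cong f (⊖-⊕ e w u)) ⟩
    φ (w ⊕ u)                               ∎

⊛-square : ∀ (f : Monomial k → Bool) ws → (f ⊛ ws ⊛ ws) ≗ (f ⊛ squares ws)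
⊛-square f ws e = begin
  (f ⊛ ws ⊛ ws) e                            ≡⟨ ⊛-⊛ f ws ws e ⟩
  ⨁ φ (ws ⊗ ws)                              ≡⟨ ⨁-cartesianProductWith φ _⊕_ ws ws ⟩
  ⨁ (λ w → ⨁ (λ u → φ (w ⊕ u)) ws) ws        ≡⟨ ⨁-diagonal (λ w u → φ (w ⊕ u)) (λ w u → cong φ (⊕-comm w u)) ws ⟩
  ⨁ (λ w → φ (w ⊕ w)) ws                     ≡⟨ ⨁-cong (λ w → cong φ (sym (unsplit-allEven w))) ws ⟩
  ⨁ (φ ∘ unsplit allEven) ws                 ≡⟨ sym (⨁-map φ (unsplit allEven) ws) ⟩
  (f ⊛ squares ws) e           ∎
  where
  open ≡-Reasoning
  φ : Monomial _ → Bool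
  φ v = (v ≼ e) ∧ f (e ⊖ v)

atSquares-⊛ : ∀ (g : Monomial k → Bool) ws r q → (atSquares g ⊛ ws) (unsplit r q) ≡ (g ⊛ parityPart r ws) q
atSquares-⊛ g ws r q = begin
  ⨁ (λ w → (w ≼ e) ∧ (does (parity (e ⊖ w) ≟ᵖ allEven) ∧ g (half (e ⊖ w)))) ws
    ≡⟨ ⨁-cong term ws ⟩
  ⨁ (λ w → does (parity w ≟ᵖ r) ∧ φ (half w)) ws
    ≡⟨ sym (⨁-filter (φ ∘ half) (λ w → parity w ≟ᵖ r) ws) ⟩
  ⨁ (φ ∘ half) (filter (λ w → parity w ≟ᵖ r) ws)
    ≡⟨ sym (⨁-map φ half (filter (λ w → parity w ≟ᵖ r) ws)) ⟩
  (g ⊛ parityPart r ws) q ∎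
  where
  open ≡-Reasoning
  e = unsplit r q
  φ : Monomial _ → Bool
  φ v = (v ≼ q) ∧ g (q ⊖ v)
  term : ∀ w → ((w ≼ e) ∧ (does (parity (e ⊖ w) ≟ᵖ allEven) ∧ g (half (e ⊖ w))))
             ≡ (does (parity w ≟ᵖ r) ∧ φ (half w))
  term w = begin
    (w ≼ e) ∧ (does (parity (e ⊖ w) ≟ᵖ allEven) ∧ g (half (e ⊖ w)))
      ≡⟨ sym (∧-assoc (w ≼ e) _ _) ⟩
    ((w ≼ e) ∧ does (parity (e ⊖ w) ≟ᵖ allEven)) ∧ g (half (e ⊖ w))
      ≡⟨ cong (_∧ g (half (e ⊖ w))) (≼-unsplit r q w) ⟩
    (does (parity w ≟ᵖ r) ∧ (half w ≼ q)) ∧ g (half (e ⊖ w))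
      ≡⟨ ∧-assoc (does (parity w ≟ᵖ r)) _ _ ⟩
    does (parity w ≟ᵖ r) ∧ ((half w ≼ q) ∧ g (half (e ⊖ w)))
      ≡⟨ does-∧-cong (parity w ≟ᵖ r) (λ eq → cong (λ v → (half w ≼ q) ∧ g v) (half-unsplit-⊖ r q w eq)) ⟩
    does (parity w ≟ᵖ r) ∧ φ (half w) ∎

atSquares-⊛-squares : ∀ (f : Monomial k → Bool) ws →
  (atSquares f ⊛ squares ws) ≗ atSquares (f ⊛ ws)
atSquares-⊛-squares f ws e = begin
  (atSquares f ⊛ squares ws) e
    ≡⟨ cong (atSquares f ⊛ squares ws) (sym (unsplit-parity-half e)) ⟩
  (atSquares f ⊛ squares ws) (unsplit r q)
    ≡⟨ atSquares-⊛ f (squares ws) r q ⟩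
  ⨁ φ (map half (filter (λ w → parity w ≟ᵖ r) (squares ws)))
    ≡⟨ trans (⨁-map φ half (filter P? (squares ws)))
             (trans (⨁-filter (φ ∘ half) P? (squares ws)) (⨁-map _ (unsplit allEven) ws)) ⟩
  ⨁ (λ w → does (parity (unsplit allEven w) ≟ᵖ r) ∧ φ (half (unsplit allEven w))) ws
    ≡⟨ ⨁-cong term ws ⟩
  ⨁ (λ w → does (r ≟ᵖ allEven) ∧ φ w) ws
    ≡⟨ ⨁-∧ˡ (does (r ≟ᵖ allEven)) φ ws ⟩
  atSquares (f ⊛ ws) e ∎
  where
  open ≡-Reasoning
  r = parity e
  q = half e
  P? : ∀ w → Dec (parity w ≡ r)
  P? w = parity w ≟ᵖ r
  φ : Monomial _ → Bool
  φ v = (v ≼ q) ∧ f (q ⊖ v)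
  term : ∀ w → (does (parity (unsplit allEven w) ≟ᵖ r) ∧ φ (half (unsplit allEven w))) ≡ (does (r ≟ᵖ allEven) ∧ φ w)
  term w = cong₂ _∧_
    (trans (cong (λ p → does (p ≟ᵖ r)) (parity-unsplit allEven w)) (does-⇔ (mk⇔ sym sym) (allEven ≟ᵖ r) (r ≟ᵖ allEven)))
    (cong φ (half-unsplit allEven w))

infixr 5 _<ˡᵉˣ_

_<ˡᵉˣ_ : Monomial k → Monomial k → Bool
[]       <ˡᵉˣ []       = false
(x ∷ xs) <ˡᵉˣ (y ∷ ys) = (x <ᵇ y) ∨ ((x ≡ᵇ y) ∧ (xs <ˡᵉˣ ys))

-- normalize ws is the canonical form of Σ_{w ∈ ws} xʷ over 𝔽₂: sorted, without repetitions.
toggle : Monomial k → List (Monomial k) → List (Monomial k)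
toggle x []       = x ∷ []
toggle x (y ∷ ys) with does (x ≟ᵐ y)
... | true  = ys
... | false = if x <ˡᵉˣ y then x ∷ y ∷ ys else y ∷ toggle x ys

normalize : List (Monomial k) → List (Monomial k)
normalize = foldr toggle []

⨁-toggle : ∀ (φ : Monomial k → Bool) x ys → ⨁ φ (toggle x ys) ≡ φ x xor ⨁ φ ys
⨁-toggle φ x []       = refl
⨁-toggle φ x (y ∷ ys) with x ≟ᵐ y
... | yes refl = sym (trans (sym (xor-assoc (φ x) (φ x) _)) (cong (_xor ⨁ φ ys) (xor-same (φ x))))
... | no  _    with x <ˡᵉˣ y
...   | true  = refl
...   | false = begin
  φ y xor ⨁ φ (toggle x ys) ≡⟨ cong (φ y xor_) (⨁-toggle φ x ys) ⟩
  φ y xor (φ x xor ⨁ φ ys)  ≡⟨ sym (xor-assoc (φ y) _ _) ⟩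
  (φ y xor φ x) xor ⨁ φ ys  ≡⟨ cong (_xor ⨁ φ ys) (xor-comm (φ y) (φ x)) ⟩
  (φ x xor φ y) xor ⨁ φ ys  ≡⟨ xor-assoc (φ x) _ _ ⟩
  φ x xor (φ y xor ⨁ φ ys)  ∎
  where open ≡-Reasoning

⊛-normalize : ∀ (f : Monomial k → Bool) ws → (f ⊛ normalize ws) ≗ (f ⊛ ws)
⊛-normalize f ws e = go ws
  where
  go : ∀ ws → ⨁ (λ w → (w ≼ e) ∧ f (e ⊖ w)) (normalize ws) ≡ (f ⊛ ws) e
  go []       = refl
  go (w ∷ ws) = trans (⨁-toggle _ w (normalize ws)) (cong (((w ≼ e) ∧ f (e ⊖ w)) xor_) (go ws))

-- Counting by parity classes

Σᵖ : (Vec Bool k → ℕ) → ℕ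
Σᵖ {zero}  g = g []
Σᵖ {suc k} g = Σᵖ (g ∘ (false ∷_)) + Σᵖ (g ∘ (true ∷_))

Σᵖ-cong : ∀ {g h : Vec Bool k → ℕ} → g ≗ h → Σᵖ g ≡ Σᵖ h
Σᵖ-cong {zero}  g≗h = g≗h []
Σᵖ-cong {suc k} g≗h = cong₂ _+_ (Σᵖ-cong (g≗h ∘ (false ∷_))) (Σᵖ-cong (g≗h ∘ (true ∷_)))

Σᵖ-zero : Σᵖ {k} (λ _ → 0) ≡ 0
Σᵖ-zero {zero}  = refl
Σᵖ-zero {suc k} = cong₂ _+_ (Σᵖ-zero {k}) (Σᵖ-zero {k})

Σᵖ-+ : ∀ (g h : Vec Bool k → ℕ) → Σᵖ (λ r → g r + h r) ≡ Σᵖ g + Σᵖ h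
Σᵖ-+ {zero}  g h = refl
Σᵖ-+ {suc k} g h = trans (cong₂ _+_ (Σᵖ-+ (g ∘ (false ∷_)) _) (Σᵖ-+ (g ∘ (true ∷_)) _))
                          (Plus.interchange (Σᵖ (g ∘ (false ∷_))) (Σᵖ (h ∘ (false ∷_))) (Σᵖ (g ∘ (true ∷_))) _)

Σᵖ-*ʳ : ∀ (g : Vec Bool k → ℕ) c → Σᵖ (λ r → g r * c) ≡ Σᵖ g * c
Σᵖ-*ʳ {zero}  g c = refl
Σᵖ-*ʳ {suc k} g c =
  trans (cong₂ _+_ (Σᵖ-*ʳ (g ∘ (false ∷_)) c) (Σᵖ-*ʳ (g ∘ (true ∷_)) c))
        (sym (ℕ.*-distribʳ-+ c (Σᵖ (g ∘ (false ∷_))) (Σᵖ (g ∘ (true ∷_)))))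

Σᵖ-indicator : ∀ (v : Vec Bool k) → Σᵖ (λ r → bit (does (v ≟ᵖ r))) ≡ 1
Σᵖ-indicator []          = refl
Σᵖ-indicator {suc k} (false ∷ v) = cong₂ _+_ (Σᵖ-indicator v) (Σᵖ-zero {k})
Σᵖ-indicator {suc k} (true  ∷ v) = cong₂ _+_ (Σᵖ-zero {k}) (Σᵖ-indicator v)

length-filter-∷ : ∀ {P : A → Set} (P? : Decidable P) x xs →
                  length (filter P? (x ∷ xs)) ≡ bit (does (P? x)) + length (filter P? xs)
length-filter-∷ P? x xs with does (P? x)
... | true  = refl
... | false = refl

length-partition : ∀ (cls : A → Vec Bool k) xs → length xs ≡ Σᵖ (λ r → length (filter (λ x → cls x ≟ᵖ r) xs))
length-partition {k = k} cls [] = sym (Σᵖ-zero {k})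
length-partition cls (x ∷ xs) = sym (begin
  Σᵖ (λ r → length (filter (λ y → cls y ≟ᵖ r) (x ∷ xs)))
    ≡⟨ Σᵖ-cong (λ r → length-filter-∷ (λ y → cls y ≟ᵖ r) x xs) ⟩
  Σᵖ (λ r → bit (does (cls x ≟ᵖ r)) + length (filter (λ y → cls y ≟ᵖ r) xs))
    ≡⟨ Σᵖ-+ (λ r → bit (does (cls x ≟ᵖ r))) _ ⟩
  Σᵖ (λ r → bit (does (cls x ≟ᵖ r))) + Σᵖ (λ r → length (filter (λ y → cls y ≟ᵖ r) xs))
    ≡⟨ cong₂ _+_ (Σᵖ-indicator (cls x)) (sym (length-partition cls xs)) ⟩
  suc (length xs) ∎)
  where open ≡-Reasoning

all-parities? : ∀ {P : Vec Bool k → Set} → (∀ r → Dec (P r)) → Dec (∀ r → P r)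
all-parities? {zero}  P? = map′ (λ p → λ { [] → p }) (λ f → f []) (P? [])
all-parities? {suc k} P? = map′ (λ (f , t) → λ { (false ∷ r) → f r ; (true ∷ r) → t r })
                                (λ g → g ∘ (false ∷_) , g ∘ (true ∷_))
                                (all-parities? (P? ∘ (false ∷_)) ×-dec all-parities? (P? ∘ (true ∷_)))

open module MonomialMembership {k} = Membership (_≟ᵐ_ {k})
open module MonomialSetConvolution {k} = SetConvolution (_≟ᵐ_ {k}) _⊕_

∈ᵇ-∇ : ∀ (cs ys : List (Monomial k)) e → e ∈ᵇ (cs ∇ ys) ≡ ((_∈ᵇ ys) ⊛ cs) e
∈ᵇ-∇ []       ys e = refl
∈ᵇ-∇ (c ∷ cs) ys e = trans (∈ᵇ-△ e (c · ys) (cs ∇ ys))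
  (cong₂ _xor_ (∈ᵇ-map (c ⊕_) e (c ≼ e) (e ⊖ c) (≟-⊕ e c) ys) (∈ᵇ-∇ cs ys e))

⊛-unique : ∀ cs {ys : List (Monomial k)} → Unique ys → ∀ e →
           ((_∈ᵇ ys) ⊛ cs) e ≡ ⨁ (λ c → ⨁ (λ y → does (e ≟ᵐ c ⊕ y)) ys) cs
⊛-unique cs {ys} uys e = ⨁-cong term cs
  where
  term : ∀ c → ((c ≼ e) ∧ (e ⊖ c) ∈ᵇ ys) ≡ ⨁ (λ y → does (e ≟ᵐ c ⊕ y)) ys
  term c = begin
    (c ≼ e) ∧ (e ⊖ c) ∈ᵇ ys                        ≡⟨ cong ((c ≼ e) ∧_) (∈ᵇ-unique (e ⊖ c) uys) ⟩
    (c ≼ e) ∧ ⨁ (λ y → does (e ⊖ c ≟ᵐ y)) ys       ≡⟨ sym (⨁-∧ˡ (c ≼ e) _ ys) ⟩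
    ⨁ (λ y → (c ≼ e) ∧ does (e ⊖ c ≟ᵐ y)) ys       ≡⟨ ⨁-cong (λ y → sym (≟-⊕ e c y)) ys ⟩
    ⨁ (λ y → does (e ≟ᵐ c ⊕ y)) ys                 ∎
    where open ≡-Reasoning

-- For sets both sides count, modulo 2, the ways of writing e = c ⊕ y with c ∈ cs and y ∈ ys.
⊛-comm : ∀ {cs ys : List (Monomial k)} → Unique cs → Unique ys → ((_∈ᵇ ys) ⊛ cs) ≗ ((_∈ᵇ cs) ⊛ ys)
⊛-comm {cs = cs} {ys} ucs uys e = begin
  ((_∈ᵇ ys) ⊛ cs) e                                ≡⟨ ⊛-unique cs uys e ⟩
  ⨁ (λ c → ⨁ (λ y → does (e ≟ᵐ c ⊕ y)) ys) cs      ≡⟨ ⨁-comm (λ c y → does (e ≟ᵐ c ⊕ y)) cs ys ⟩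
  ⨁ (λ y → ⨁ (λ c → does (e ≟ᵐ c ⊕ y)) cs) ys      ≡⟨ ⨁-cong (λ y → ⨁-cong (λ c → cong (does ∘ (e ≟ᵐ_)) (⊕-comm c y)) cs) ys ⟩
  ⨁ (λ y → ⨁ (λ c → does (e ≟ᵐ y ⊕ c)) cs) ys      ≡⟨ sym (⊛-unique ys ucs e) ⟩
  ((_∈ᵇ cs) ⊛ ys) e                                ∎
  where open ≡-Reasoning

-- Λ splits by parity into the images of the M r under q ↦ unsplit r q.
length-split : ∀ {Λ : List (Monomial k)} {M : Vec Bool k → List (Monomial k)} → Unique Λ → (∀ r → Unique (M r)) →
               (∀ r q → unsplit r q ∈ᵇ Λ ≡ q ∈ᵇ M r) → length Λ ≡ Σᵖ (λ r → length (M r))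
length-split {Λ = Λ} {M} uΛ uM same = trans (length-partition parity Λ) (Σᵖ-cong part)
  where
  unsplit-injective : ∀ r {x y} → unsplit r x ≡ unsplit r y → x ≡ y
  unsplit-injective r {x} {y} eq = trans (sym (half-unsplit r x)) (trans (cong half eq) (half-unsplit r y))
  mem : ∀ r e → e ∈ᵇ (filter (λ e → parity e ≟ᵖ r) Λ) ≡ e ∈ᵇ (map (unsplit r) (M r))
  mem r e = begin
    e ∈ᵇ (filter (λ e → parity e ≟ᵖ r) Λ)   ≡⟨ ∈ᵇ-filter (λ e → parity e ≟ᵖ r) e Λ ⟩
    does (parity e ≟ᵖ r) ∧ e ∈ᵇ Λ           ≡⟨ does-∧-cong (parity e ≟ᵖ r) at-parity-r ⟩
    does (parity e ≟ᵖ r) ∧ half e ∈ᵇ M r    ≡⟨ sym (∈ᵇ-map (unsplit r) e _ (half e) (≟-unsplit e r) (M r)) ⟩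
    e ∈ᵇ (map (unsplit r) (M r))            ∎
    where
    open ≡-Reasoning
    at-parity-r : parity e ≡ r → e ∈ᵇ Λ ≡ half e ∈ᵇ M r
    at-parity-r refl = trans (cong (_∈ᵇ Λ) (sym (unsplit-parity-half e))) (same (parity e) (half e))
  part : ∀ r → length (filter (λ e → parity e ≟ᵖ r) Λ) ≡ length (M r)
  part r = trans (length-≗ (Unique.filter⁺ (λ e → parity e ≟ᵖ r) uΛ) (Unique.map⁺ (unsplit-injective r) (uM r)) (mem r))
                 (length-map (unsplit r) (M r))

-- Powers of a polynomial

module Powers (U : List (Monomial k)) (U-unique : Unique U) where

  powers : ℕ → List (Monomial k)
  powers zero    = 𝟎 ∷ []
  powers (suc n) = powers n ∇ U

  powers-unique : ∀ n → Unique (powers n)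
  powers-unique zero    = [] ∷ []
  powers-unique (suc n) = ∇-unique ⊕-cancelˡ (powers n) U-unique

  ∈ᵇ-powers-suc : ∀ n → (_∈ᵇ powers (suc n)) ≗ ((_∈ᵇ powers n) ⊛ U)
  ∈ᵇ-powers-suc n e = trans (∈ᵇ-∇ (powers n) U e) (⊛-comm (powers-unique n) U-unique e)

  ∈ᵇ-powers-double : ∀ m → (_∈ᵇ powers (pushBit false m)) ≗ atSquares (_∈ᵇ powers m)
  ∈ᵇ-powers-double zero e = begin
    does (e ≟ᵐ 𝟎) ∨ false                                      ≡⟨ ∨-identityʳ _ ⟩
    does (e ≟ᵐ 𝟎)                                              ≡⟨ cong (does ∘ (e ≟ᵐ_)) (sym unsplit-allEven-𝟎) ⟩
    does (e ≟ᵐ unsplit allEven 𝟎)                              ≡⟨ ≟-unsplit e allEven 𝟎 ⟩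
    does (parity e ≟ᵖ allEven) ∧ does (half e ≟ᵐ 𝟎)            ≡⟨ cong (does (parity e ≟ᵖ allEven) ∧_) (sym (∨-identityʳ _)) ⟩
    does (parity e ≟ᵖ allEven) ∧ (does (half e ≟ᵐ 𝟎) ∨ false)  ∎
    where
    open ≡-Reasoning
    unsplit-allEven-𝟎 : ∀ {k} → unsplit allEven 𝟎 ≡ 𝟎 {k}
    unsplit-allEven-𝟎 {zero}  = refl
    unsplit-allEven-𝟎 {suc k} = cong (0 ∷_) unsplit-allEven-𝟎
  ∈ᵇ-powers-double (suc m) e = begin
    e ∈ᵇ powers (suc (suc n))                               ≡⟨ ∈ᵇ-powers-suc (suc n) e ⟩
    ((_∈ᵇ powers (suc n)) ⊛ U) e                            ≡⟨ ⊛-cong (∈ᵇ-powers-suc n) U e ⟩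
    ((_∈ᵇ powers n) ⊛ U ⊛ U) e                              ≡⟨ ⊛-cong (⊛-cong (∈ᵇ-powers-double m) U) U e ⟩
    (atSquares (_∈ᵇ powers m) ⊛ U ⊛ U) e                    ≡⟨ ⊛-square (atSquares (_∈ᵇ powers m)) U e ⟩
    (atSquares (_∈ᵇ powers m) ⊛ squares U) e  ≡⟨ atSquares-⊛-squares (_∈ᵇ powers m) U e ⟩
    atSquares ((_∈ᵇ powers m) ⊛ U) e                        ≡⟨ cong (does (parity e ≟ᵖ allEven) ∧_)
                                                                   (sym (∈ᵇ-powers-suc m (half e))) ⟩
    atSquares (_∈ᵇ powers (suc m)) e                        ∎
    where
    open ≡-Reasoning
    n = pushBit false m

  -- count n ws is the number of monomials of (Σ_{w ∈ ws} xʷ) · Uⁿ over 𝔽₂.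
  count : ℕ → List (Monomial k) → ℕ
  count n ws = length (ws ∇ powers n)

  count-unique : ∀ n ws → Unique (ws ∇ powers n)
  count-unique n ws = ∇-unique ⊕-cancelˡ ws (powers-unique n)

  count-≗ : ∀ {n n′ ws ws′} → ((_∈ᵇ powers n) ⊛ ws) ≗ ((_∈ᵇ powers n′) ⊛ ws′) → count n ws ≡ count n′ ws′
  count-≗ {n} {n′} {ws} {ws′} eq = length-≗ (count-unique n ws) (count-unique n′ ws′)
    (λ e → trans (∈ᵇ-∇ ws (powers n) e) (trans (eq e) (sym (∈ᵇ-∇ ws′ (powers n′) e))))

  count-normalize : ∀ m ws → count m (normalize ws) ≡ count m ws
  count-normalize m ws = count-≗ {m} {m} {normalize ws} {ws} (⊛-normalize (_∈ᵇ powers m) ws)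

  length-powers : ∀ n → length (powers n) ≡ count n (𝟎 ∷ [])
  length-powers n = length-≗ (powers-unique n) (count-unique n (𝟎 ∷ [])) mem
    where
    mem : ∀ e → e ∈ᵇ powers n ≡ e ∈ᵇ ((𝟎 ∷ []) ∇ powers n)
    mem e rewrite ∈ᵇ-∇ (𝟎 ∷ []) (powers n) e | 𝟎-≼ e | ⊖-𝟎 e = sym (xor-identityʳ _)

  count-split : ∀ {n m ws ws′} → ((_∈ᵇ powers n) ⊛ ws) ≗ (atSquares (_∈ᵇ powers m) ⊛ ws′) →
                count n ws ≡ Σᵖ (λ r → count m (parityPart r ws′))
  count-split {n} {m} {ws} {ws′} eq = length-split (count-unique n ws) (λ r → count-unique m (parityPart r ws′)) same
    where
    same : ∀ r q → unsplit r q ∈ᵇ (ws ∇ powers n) ≡ q ∈ᵇ (parityPart r ws′ ∇ powers m)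
    same r q = begin
      unsplit r q ∈ᵇ (ws ∇ powers n)                  ≡⟨ ∈ᵇ-∇ ws (powers n) (unsplit r q) ⟩
      ((_∈ᵇ powers n) ⊛ ws) (unsplit r q)             ≡⟨ eq (unsplit r q) ⟩
      (atSquares (_∈ᵇ powers m) ⊛ ws′) (unsplit r q)  ≡⟨ atSquares-⊛ (_∈ᵇ powers m) ws′ r q ⟩
      ((_∈ᵇ powers m) ⊛ parityPart r ws′) q           ≡⟨ sym (∈ᵇ-∇ (parityPart r ws′) (powers m) q) ⟩
      q ∈ᵇ (parityPart r ws′ ∇ powers m)              ∎
      where open ≡-Reasoning

  infixl 6 _·U^_

  _·U^_ : List (Monomial k) → Bool → List (Monomial k)
  ws ·U^ false = ws
  ws ·U^ true  = ws ⊗ U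

  count-pushBit : ∀ b m ws → count (pushBit b m) ws ≡ Σᵖ (λ r → count m (parityPart r (ws ·U^ b)))
  count-pushBit false m ws = count-split {pushBit false m} {m} {ws} {ws} (⊛-cong (∈ᵇ-powers-double m) ws)
  count-pushBit true  m ws = trans (cong (λ n → count n ws) (pushBit-true m))
                                   (count-split {suc (pushBit false m)} {m} {ws} {ws ⊗ U} factor-U)
    where
    factor-U : ((_∈ᵇ powers (suc (pushBit false m))) ⊛ ws) ≗ (atSquares (_∈ᵇ powers m) ⊛ (ws ⊗ U))
    factor-U e = begin
      ((_∈ᵇ powers (suc (pushBit false m))) ⊛ ws) e     ≡⟨ ⊛-cong (∈ᵇ-powers-suc (pushBit false m)) ws e ⟩
      ((_∈ᵇ powers (pushBit false m)) ⊛ U ⊛ ws) e       ≡⟨ ⊛-⊛ (_∈ᵇ powers (pushBit false m)) U ws e ⟩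
      ((_∈ᵇ powers (pushBit false m)) ⊛ (ws ⊗ U)) e     ≡⟨ ⊛-cong (∈ᵇ-powers-double m) (ws ⊗ U) e ⟩
      (atSquares (_∈ᵇ powers m) ⊛ (ws ⊗ U)) e           ∎
      where open ≡-Reasoning

-- The exponent vectors of 1, 2, …, 8 with respect to the primes 2, 3, 5, 7.
H : List (Monomial 4)
H = (0 ∷ 0 ∷ 0 ∷ 0 ∷ []) ∷ (1 ∷ 0 ∷ 0 ∷ 0 ∷ []) ∷ (0 ∷ 1 ∷ 0 ∷ 0 ∷ []) ∷ (2 ∷ 0 ∷ 0 ∷ 0 ∷ []) ∷
    (0 ∷ 0 ∷ 1 ∷ 0 ∷ []) ∷ (1 ∷ 1 ∷ 0 ∷ 0 ∷ []) ∷ (0 ∷ 0 ∷ 0 ∷ 1 ∷ []) ∷ (3 ∷ 0 ∷ 0 ∷ 0 ∷ []) ∷ []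

open Powers H (from-yes (unique? _≟ᵐ_ H))

data State : Set where
  one one+x one+x² : State

poly : State → List (Monomial 4)
poly one    = 𝟎 ∷ []
poly one+x  = 𝟎 ∷ (1 ∷ 0 ∷ 0 ∷ 0 ∷ []) ∷ []
poly one+x² = 𝟎 ∷ (2 ∷ 0 ∷ 0 ∷ 0 ∷ []) ∷ []

Σₛ : (State → ℕ) → ℕ
Σₛ f = f one + f one+x + f one+x²

counts : ℕ → State → ℕ
counts m s = count m (poly s)

_≟ˡ_ : DecidableEquality (List (Monomial 4))
_≟ˡ_ = ≡-dec _≟ᵐ_

Classified : List (Monomial 4) → Set
Classified ws = Any (normalize ws ≡_) ([] ∷ poly one ∷ poly one+x ∷ poly one+x² ∷ [])

classified? : ∀ ws → Dec (Classified ws)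
classified? ws = any? (normalize ws ≟ˡ_) _

Classification : ℕ → List (Monomial 4) → Set
Classification m ws = count m ws ≡ Σₛ (λ s → bit (does (ws ≟ˡ poly s)) * counts m s)

count-poly : ∀ m s → Classification m (poly s)
count-poly m one    = sym (trans (ℕ.+-identityʳ _) (trans (ℕ.+-identityʳ _) (ℕ.+-identityʳ _)))
count-poly m one+x  = sym (trans (ℕ.+-identityʳ _) (ℕ.+-identityʳ _))
count-poly m one+x² = sym (ℕ.+-identityʳ _)

count-classified : ∀ m ws → Classified ws → Classification m (normalize ws)
count-classified m ws (here eq)                         = subst (Classification m) (sym eq) refl
count-classified m ws (there (here eq))                 = subst (Classification m) (sym eq) (count-poly m one)
count-classified m ws (there (there (here eq)))         = subst (Classification m) (sym eq) (count-poly m one+x)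
count-classified m ws (there (there (there (here eq)))) = subst (Classification m) (sym eq) (count-poly m one+x²)

-- The matrix M_b, with counts (2m + b) = M_b · counts m.
transition : Bool → State → State → ℕ
transition b s s′ = Σᵖ (λ r → bit (does (normalize (parityPart r (poly s ·U^ b)) ≟ˡ poly s′)))

parityParts-classified? : ∀ b s → Dec (∀ r → Classified (parityPart r (poly s ·U^ b)))
parityParts-classified? b s = all-parities? (λ r → classified? (parityPart r (poly s ·U^ b)))

parityParts-classified : ∀ b s r → Classified (parityPart r (poly s ·U^ b))
parityParts-classified false one    = from-yes (parityParts-classified? false one)
parityParts-classified false one+x  = from-yes (parityParts-classified? false one+x)
parityParts-classified false one+x² = from-yes (parityParts-classified? false one+x²)
parityParts-classified true  one    = from-yes (parityParts-classified? true one)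
parityParts-classified true  one+x  = from-yes (parityParts-classified? true one+x)
parityParts-classified true  one+x² = from-yes (parityParts-classified? true one+x²)

Σᵖ-Σₛ : ∀ (a : Vec Bool 4 → State → ℕ) (c : State → ℕ) →
        Σᵖ (λ r → Σₛ (λ s → a r s * c s)) ≡ Σₛ (λ s → Σᵖ (λ r → a r s) * c s)
Σᵖ-Σₛ a c = begin
  Σᵖ (λ r → a r one * c one + a r one+x * c one+x + a r one+x² * c one+x²)
    ≡⟨ Σᵖ-+ (λ r → a r one * c one + a r one+x * c one+x) (λ r → a r one+x² * c one+x²) ⟩
  Σᵖ (λ r → a r one * c one + a r one+x * c one+x) + Σᵖ (λ r → a r one+x² * c one+x²)
    ≡⟨ cong (_+ Σᵖ (λ r → a r one+x² * c one+x²)) (Σᵖ-+ (λ r → a r one * c one) (λ r → a r one+x * c one+x)) ⟩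
  Σᵖ (λ r → a r one * c one) + Σᵖ (λ r → a r one+x * c one+x) + Σᵖ (λ r → a r one+x² * c one+x²)
    ≡⟨ cong₂ _+_ (cong₂ _+_ (Σᵖ-*ʳ (λ r → a r one) _) (Σᵖ-*ʳ (λ r → a r one+x) _)) (Σᵖ-*ʳ (λ r → a r one+x²) _) ⟩
  Σₛ (λ s → Σᵖ (λ r → a r s) * c s) ∎
  where open ≡-Reasoning

counts-pushBit : ∀ b s m → counts (pushBit b m) s ≡ Σₛ (λ s′ → transition b s s′ * counts m s′)
counts-pushBit b s m = begin
  count (pushBit b m) (poly s)
    ≡⟨ count-pushBit b m (poly s) ⟩
  Σᵖ (λ r → count m (part r))
    ≡⟨ Σᵖ-cong (λ r → trans (sym (count-normalize m (part r))) (count-classified m (part r) (parityParts-classified b s r))) ⟩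
  Σᵖ (λ r → Σₛ (λ s′ → bit (does (normalize (part r) ≟ˡ poly s′)) * counts m s′))
    ≡⟨ Σᵖ-Σₛ (λ r s′ → bit (does (normalize (part r) ≟ˡ poly s′))) (counts m) ⟩
  Σₛ (λ s′ → transition b s s′ * counts m s′) ∎
  where
  open ≡-Reasoning
  part : Vec Bool 4 → List (Monomial 4)
  part r = parityPart r (poly s ·U^ b)

record Related (n m₁ m₂ m₃ : ℕ) : Set where
  constructor related
  field
    at : ∀ s → counts n s + 2 * counts m₂ s + 24 * counts m₃ s ≡ 7 * counts m₁ s

Related-cong : ∀ {n m₁ m₂ m₃ n′ m₁′ m₂′ m₃′} → n ≡ n′ → m₁ ≡ m₁′ → m₂ ≡ m₂′ → m₃ ≡ m₃′ →
               Related n m₁ m₂ m₃ → Related n′ m₁′ m₂′ m₃′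
Related-cong refl refl refl refl R = R

linear-combination : ∀ p q r {a₁ a₂ a₃ a₄ b₁ b₂ b₃ b₄ c₁ c₂ c₃ c₄} →
  a₁ + 2 * a₃ + 24 * a₄ ≡ 7 * a₂ → b₁ + 2 * b₃ + 24 * b₄ ≡ 7 * b₂ → c₁ + 2 * c₃ + 24 * c₄ ≡ 7 * c₂ →
  (p * a₁ + q * b₁ + r * c₁) + 2 * (p * a₃ + q * b₃ + r * c₃) + 24 * (p * a₄ + q * b₄ + r * c₄)
    ≡ 7 * (p * a₂ + q * b₂ + r * c₂)
linear-combination p q r {a₁} {a₂} {a₃} {a₄} {b₁} {b₂} {b₃} {b₄} {c₁} {c₂} {c₃} {c₄} ea eb ec = begin
  (p * a₁ + q * b₁ + r * c₁) + 2 * (p * a₃ + q * b₃ + r * c₃) + 24 * (p * a₄ + q * b₄ + r * c₄)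
    ≡⟨ regroup p q r a₁ a₃ a₄ b₁ b₃ b₄ c₁ c₃ c₄ ⟩
  p * (a₁ + 2 * a₃ + 24 * a₄) + q * (b₁ + 2 * b₃ + 24 * b₄) + r * (c₁ + 2 * c₃ + 24 * c₄)
    ≡⟨ cong₂ _+_ (cong₂ _+_ (cong (p *_) ea) (cong (q *_) eb)) (cong (r *_) ec) ⟩
  p * (7 * a₂) + q * (7 * b₂) + r * (7 * c₂)
    ≡⟨ factor p q r a₂ b₂ c₂ ⟩
  7 * (p * a₂ + q * b₂ + r * c₂) ∎
  where
  open ≡-Reasoning
  regroup : ∀ p q r a₁ a₃ a₄ b₁ b₃ b₄ c₁ c₃ c₄ →
    (p * a₁ + q * b₁ + r * c₁) + 2 * (p * a₃ + q * b₃ + r * c₃) + 24 * (p * a₄ + q * b₄ + r * c₄)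
      ≡ p * (a₁ + 2 * a₃ + 24 * a₄) + q * (b₁ + 2 * b₃ + 24 * b₄) + r * (c₁ + 2 * c₃ + 24 * c₄)
  regroup = solve-∀
  factor : ∀ p q r a b c → p * (7 * a) + q * (7 * b) + r * (7 * c) ≡ 7 * (p * a + q * b + r * c)
  factor = solve-∀

Related-pushBit : ∀ b {n m₁ m₂ m₃} → Related n m₁ m₂ m₃ →
                  Related (pushBit b n) (pushBit b m₁) (pushBit b m₂) (pushBit b m₃)
Related-pushBit b {n} {m₁} {m₂} {m₃} (related R) = related at
  where
  open ≡-Reasoning
  image : State → ℕ → ℕ
  image s x = Σₛ (λ s′ → transition b s s′ * counts x s′)
  at : ∀ s → counts (pushBit b n) s + 2 * counts (pushBit b m₂) s + 24 * counts (pushBit b m₃) s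
             ≡ 7 * counts (pushBit b m₁) s
  at s = begin
    counts (pushBit b n) s + 2 * counts (pushBit b m₂) s + 24 * counts (pushBit b m₃) s
      ≡⟨ cong₂ _+_ (cong₂ _+_ (counts-pushBit b s n) (cong (2 *_) (counts-pushBit b s m₂)))
                   (cong (24 *_) (counts-pushBit b s m₃)) ⟩
    image s n + 2 * image s m₂ + 24 * image s m₃
      ≡⟨ linear-combination (transition b s one) (transition b s one+x) (transition b s one+x²)
                            (R one) (R one+x) (R one+x²) ⟩
    7 * image s m₁
      ≡⟨ cong (7 *_) (sym (counts-pushBit b s m₁)) ⟩
    7 * counts (pushBit b m₁) s ∎

-- (a′, b′, c′) = M₁ (a, b, c) for the matrix M₁ = transition true.
record OddStep (a b c a′ b′ c′ : ℕ) : Set where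
  constructor oddStep
  field
    step₁ : a′ ≡ 4 * a + 2 * b + 0 * c
    step₂ : b′ ≡ 4 * a + 1 * b + 1 * c
    step₃ : c′ ≡ 0 * a + 4 * b + 2 * c

counts-odd : ∀ m → OddStep (counts m one) (counts m one+x) (counts m one+x²)
                           (counts (pushBit true m) one) (counts (pushBit true m) one+x) (counts (pushBit true m) one+x²)
counts-odd m = oddStep (counts-pushBit true one m) (counts-pushBit true one+x m) (counts-pushBit true one+x² m)

-- Cayley–Hamilton: M₁ has characteristic polynomial X³ − 7X² + 2X + 24.
cayley-hamilton : ∀ {a b c a₁ b₁ c₁ a₂ b₂ c₂ a₃ b₃ c₃} →
  OddStep a b c a₁ b₁ c₁ → OddStep a₁ b₁ c₁ a₂ b₂ c₂ → OddStep a₂ b₂ c₂ a₃ b₃ c₃ →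
  (a₃ + 2 * a₁ + 24 * a ≡ 7 * a₂) × (b₃ + 2 * b₁ + 24 * b ≡ 7 * b₂) × (c₃ + 2 * c₁ + 24 * c ≡ 7 * c₂)
cayley-hamilton {a} {b} {c} (oddStep refl refl refl) (oddStep refl refl refl) (oddStep refl refl refl) =
  solve (a List.∷ b List.∷ c List.∷ List.[]) ,
  solve (a List.∷ b List.∷ c List.∷ List.[]) ,
  solve (a List.∷ b List.∷ c List.∷ List.[])

Related-base : ∀ β → Related (pushBit true (pushBit true (pushBit true β))) (pushBit true (pushBit true β)) (pushBit true β) β
Related-base β = related λ where
    one    → proj₁ (cayley-hamilton odd₀ odd₁ odd₂)
    one+x  → proj₁ (proj₂ (cayley-hamilton odd₀ odd₁ odd₂))
    one+x² → proj₂ (proj₂ (cayley-hamilton odd₀ odd₁ odd₂))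
  where
  odd₀ = counts-odd β
  odd₁ = counts-odd (pushBit true β)
  odd₂ = counts-odd (pushBit true (pushBit true β))

pushBit≡ : ∀ b q → pushBit b q ≡ bit b + 2 * q
pushBit≡ b zero    = sym (ℕ.+-identityʳ (bit b))
pushBit≡ b (suc q) = trans (cong (suc ∘ suc) (pushBit≡ b q)) (shift (bit b) q)
  where
  shift : ∀ c q → 2 + (c + 2 * q) ≡ c + 2 * (1 + q)
  shift = solve-∀

half-< : ∀ {α t} → α < 2 ^ suc t → ⌊ α /2⌋ < 2 ^ t
half-< {α} {t} α< = ℕ.*-cancelˡ-< 2 ⌊ α /2⌋ (2 ^ t) (ℕ.≤-<-trans twice-half≤ α<)
  where
  twice-half≤ : 2 * ⌊ α /2⌋ ≤ α
  twice-half≤ = ℕ.≤-trans (ℕ.m≤n+m (2 * ⌊ α /2⌋) (bit (odd α)))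
                          (ℕ.≤-reflexive (trans (sym (pushBit≡ (odd α) ⌊ α /2⌋)) (pushBit-odd-half α)))

Related-prefix : ∀ {x₁ x₂ x₃ x₄} → Related x₁ x₂ x₃ x₄ → ∀ t α → α < 2 ^ t →
                 Related (α + 2 ^ t * x₁) (α + 2 ^ t * x₂) (α + 2 ^ t * x₃) (α + 2 ^ t * x₄)
Related-prefix {x₁} {x₂} {x₃} {x₄} R zero zero _ =
  Related-cong (one-digit x₁) (one-digit x₂) (one-digit x₃) (one-digit x₄) R
  where
  one-digit : ∀ x → x ≡ 0 + 1 * x
  one-digit x = sym (ℕ.+-identityʳ x)
Related-prefix R zero (suc α) (s≤s ())
Related-prefix {x₁} {x₂} {x₃} {x₄} R (suc t) α α< =
  Related-cong (lowest-digit x₁) (lowest-digit x₂) (lowest-digit x₃) (lowest-digit x₄)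
    (Related-pushBit (odd α) (Related-prefix R t ⌊ α /2⌋ (half-< {α} {t} α<)))
  where
  lowest-digit : ∀ x → pushBit (odd α) (⌊ α /2⌋ + 2 ^ t * x) ≡ α + 2 ^ suc t * x
  lowest-digit x = begin
    pushBit (odd α) (⌊ α /2⌋ + 2 ^ t * x)              ≡⟨ pushBit≡ (odd α) (⌊ α /2⌋ + 2 ^ t * x) ⟩
    bit (odd α) + 2 * (⌊ α /2⌋ + 2 ^ t * x)            ≡⟨ regroup (bit (odd α)) ⌊ α /2⌋ (2 ^ t) x ⟩
    (bit (odd α) + 2 * ⌊ α /2⌋) + 2 * 2 ^ t * x        ≡⟨ cong (λ y → y + 2 * 2 ^ t * x) (sym (pushBit≡ (odd α) ⌊ α /2⌋)) ⟩
    pushBit (odd α) ⌊ α /2⌋ + 2 * 2 ^ t * x            ≡⟨ cong (λ y → y + 2 * 2 ^ t * x) (pushBit-odd-half α) ⟩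
    α + 2 ^ suc t * x                                  ∎
    where
    open ≡-Reasoning
    regroup : ∀ c h p x → c + 2 * (h + p * x) ≡ (c + 2 * h) + 2 * p * x
    regroup = solve-∀

-- From monomials back to numbers

module Transfer {B : Set} (_≟ᴬ_ : DecidableEquality A) (_≟ᴮ_ : DecidableEquality B)
                (f : A → B) (f-injective : ∀ {x y} → f x ≡ f y → x ≡ y) where

  private
    module Aᵐ = Membership _≟ᴬ_
    module Bᵐ = Membership _≟ᴮ_

  map-filter-∉ : ∀ ys xs → map f (filter (Aᵐ._∉? ys) xs) ≡ filter (Bᵐ._∉? map f ys) (map f xs)
  map-filter-∉ ys []       = refl
  map-filter-∉ ys (x ∷ xs) with x Aᵐ.∈? ys | f x Bᵐ.∈? map f ys
  ... | yes _    | yes _     = map-filter-∉ ys xs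
  ... | no  _    | no  _     = cong (f x ∷_) (map-filter-∉ ys xs)
  ... | yes x∈ys | no  fx∉ys = contradiction (∈-map⁺ f x∈ys) fx∉ys
  ... | no  x∉ys | yes fx∈ys with ∈-map⁻ f fx∈ys
  ...   | y , y∈ys , fx≡fy = contradiction (subst (Aᵐ._∈ ys) (sym (f-injective fx≡fy)) y∈ys) x∉ys

  module _ (_∙_ : A → A → A) (_∘_ : B → B → B) (f-hom : ∀ x y → f (x ∙ y) ≡ f x ∘ f y) where

    private
      module A∇ = SetConvolution _≟ᴬ_ _∙_
      module B∇ = SetConvolution _≟ᴮ_ _∘_

    map-△ : ∀ xs ys → map f (xs A∇.△ ys) ≡ map f xs B∇.△ map f ys
    map-△ xs ys = trans (map-++ f (filter (Aᵐ._∉? ys) xs) _) (cong₂ _++_ (map-filter-∉ ys xs) (map-filter-∉ xs ys))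

    map-· : ∀ c ys → map f (c A∇.· ys) ≡ f c B∇.· map f ys
    map-· c []       = refl
    map-· c (y ∷ ys) = cong₂ _∷_ (f-hom c y) (map-· c ys)

    map-∇ : ∀ cs ys → map f (cs A∇.∇ ys) ≡ map f cs B∇.∇ map f ys
    map-∇ []       ys = refl
    map-∇ (c ∷ cs) ys = trans (map-△ (c A∇.· ys) (cs A∇.∇ ys)) (cong₂ B∇._△_ (map-· c ys) (map-∇ cs ys))

∤-* : ∀ {p x y} → Prime p → ¬ p ∣ x → ¬ p ∣ y → ¬ p ∣ x * y
∤-* {x = x} {y} p-prime p∤x p∤y p∣xy with euclidsLemma x y p-prime p∣xy
... | inj₁ p∣x = p∤x p∣x
... | inj₂ p∣y = p∤y p∣y

∤-^ : ∀ {p q} → Prime p → ¬ p ∣ q → ∀ n → ¬ p ∣ q ^ n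
∤-^ p-prime p∤q zero    p∣1 = ¬prime[1] (subst Prime (∣1⇒≡1 p∣1) p-prime)
∤-^ p-prime p∤q (suc n)     = ∤-* p-prime p∤q (∤-^ p-prime p∤q n)

^*-injective : ∀ {p} → Prime p → ∀ a a′ {x x′} → ¬ p ∣ x → ¬ p ∣ x′ → p ^ a * x ≡ p ^ a′ * x′ → a ≡ a′ × x ≡ x′
^*-injective p-prime zero     zero      p∤x p∤x′ eq = refl , trans (sym (ℕ.*-identityˡ _)) (trans eq (ℕ.*-identityˡ _))
^*-injective {p} p-prime zero (suc a′) {x} {x′} p∤x p∤x′ eq =
  contradiction (subst (p ∣_) (sym (trans (sym (ℕ.*-identityˡ x)) (trans eq (ℕ.*-assoc p (p ^ a′) x′)))) (m∣m*n _)) p∤x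
^*-injective {p} p-prime (suc a) zero {x} {x′} p∤x p∤x′ eq =
  contradiction (subst (p ∣_) (trans (sym (ℕ.*-assoc p (p ^ a) x)) (trans eq (ℕ.*-identityˡ x′))) (m∣m*n _)) p∤x′
^*-injective {p} p-prime (suc a) (suc a′) {x} {x′} p∤x p∤x′ eq
  with ^*-injective p-prime a a′ p∤x p∤x′
         (ℕ.*-cancelˡ-≡ _ _ p {{prime⇒nonZero p-prime}}
           (trans (sym (ℕ.*-assoc p (p ^ a) x)) (trans eq (ℕ.*-assoc p (p ^ a′) x′))))
... | refl , x≡x′ = refl , x≡x′

enc : Monomial 4 → ℕ
enc (a ∷ b ∷ c ∷ d ∷ []) = 2 ^ a * (3 ^ b * (5 ^ c * 7 ^ d))

enc-⊕ : ∀ u w → enc (u ⊕ w) ≡ enc u * enc w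
enc-⊕ (a ∷ b ∷ c ∷ d ∷ []) (a′ ∷ b′ ∷ c′ ∷ d′ ∷ [])
  rewrite ℕ.^-distribˡ-+-* 2 a a′ | ℕ.^-distribˡ-+-* 3 b b′ | ℕ.^-distribˡ-+-* 5 c c′ | ℕ.^-distribˡ-+-* 7 d d′ =
  regroup (2 ^ a) (2 ^ a′) (3 ^ b) (3 ^ b′) (5 ^ c) (5 ^ c′) (7 ^ d) (7 ^ d′)
  where
  regroup : ∀ a a′ b b′ c c′ d d′ → (a * a′) * ((b * b′) * ((c * c′) * (d * d′))) ≡ (a * (b * (c * d))) * (a′ * (b′ * (c′ * d′)))
  regroup = solve-∀

2∤3ᵇ5ᶜ7ᵈ : ∀ b c d → ¬ 2 ∣ 3 ^ b * (5 ^ c * 7 ^ d)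
2∤3ᵇ5ᶜ7ᵈ b c d = ∤-* prime[2] (∤-^ prime[2] (from-no (2 ∣? 3)) b)
                     (∤-* prime[2] (∤-^ prime[2] (from-no (2 ∣? 5)) c) (∤-^ prime[2] (from-no (2 ∣? 7)) d))

3∤5ᶜ7ᵈ : ∀ c d → ¬ 3 ∣ 5 ^ c * 7 ^ d
3∤5ᶜ7ᵈ c d = ∤-* prime[3] (∤-^ prime[3] (from-no (3 ∣? 5)) c) (∤-^ prime[3] (from-no (3 ∣? 7)) d)
  where prime[3] = from-yes (prime? 3)

5∤7ᵈ : ∀ d → ¬ 5 ∣ 7 ^ d
5∤7ᵈ = ∤-^ (from-yes (prime? 5)) (from-no (5 ∣? 7))

enc-injective : ∀ {u w} → enc u ≡ enc w → u ≡ w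
enc-injective {a ∷ b ∷ c ∷ d ∷ []} {a′ ∷ b′ ∷ c′ ∷ d′ ∷ []} eq₂
  with refl , eq₃ ← ^*-injective prime[2] a a′ (2∤3ᵇ5ᶜ7ᵈ b c d) (2∤3ᵇ5ᶜ7ᵈ b′ c′ d′) eq₂
  with refl , eq₅ ← ^*-injective (from-yes (prime? 3)) b b′ (3∤5ᶜ7ᵈ c d) (3∤5ᶜ7ᵈ c′ d′) eq₃
  with refl , eq₇ ← ^*-injective (from-yes (prime? 5)) c c′ (5∤7ᵈ d) (5∤7ᵈ d′) eq₅
  with refl , _   ← ^*-injective (from-yes (prime? 7)) d d′ (from-no (7 ∣? 1)) (from-no (7 ∣? 1)) (cong (_* 1) eq₇)
  = refl

module NatSets = SetConvolution ℕ._≟_ _*_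
open Transfer _≟ᵐ_ ℕ._≟_ enc enc-injective using (map-∇)

H8^∇≡ : ∀ n → H8^∇ n ≡ map enc (powers n)
H8^∇≡ zero    = refl
H8^∇≡ (suc n) = trans (cong (NatSets._∇ H8) (H8^∇≡ n)) (sym (map-∇ _⊕_ _*_ enc-⊕ (powers n) H))

card-H8^∇ : ∀ n → card (H8^∇ n) ≡ counts n one
card-H8^∇ n rewrite H8^∇≡ n = begin
  length (deduplicate ℕ._≟_ (map enc (powers n)))  ≡⟨ Membership.length-deduplicate-unique ℕ._≟_
                                                        (Unique.map⁺ enc-injective (powers-unique n)) ⟩
  length (map enc (powers n))                      ≡⟨ length-map enc (powers n) ⟩
  length (powers n)                                ≡⟨ length-powers n ⟩
  counts n one                                     ∎
  where open ≡-Reasoning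

integer-form : ∀ a b c d → a + 2 * c + 24 * d ≡ 7 * b →
               + a ≡ (+ 7) ℤ.* (+ b) ℤ.- (+ 2) ℤ.* (+ c) ℤ.- (+ 24) ℤ.* (+ d)
integer-form a b c d eq = begin
  + a                                                                      ≡⟨ cancel (+ a) (+ c) (+ d) (+ 2) (+ 24) ⟩
  (+ a ℤ.+ (+ 2) ℤ.* (+ c) ℤ.+ (+ 24) ℤ.* (+ d)) ℤ.- (+ 2) ℤ.* (+ c) ℤ.- (+ 24) ℤ.* (+ d)
    ≡⟨ cong (λ z → z ℤ.- (+ 2) ℤ.* (+ c) ℤ.- (+ 24) ℤ.* (+ d)) lhs≡ ⟩
  (+ 7) ℤ.* (+ b) ℤ.- (+ 2) ℤ.* (+ c) ℤ.- (+ 24) ℤ.* (+ d)                  ∎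
  where
  open ≡-Reasoning
  cancel : ∀ a c d k l → a ≡ (a ℤ.+ k ℤ.* c ℤ.+ l ℤ.* d) ℤ.- k ℤ.* c ℤ.- l ℤ.* d
  cancel = ℤSolver.solve-∀
  lhs≡ : + a ℤ.+ (+ 2) ℤ.* (+ c) ℤ.+ (+ 24) ℤ.* (+ d) ≡ (+ 7) ℤ.* (+ b)
  lhs≡ = begin
    + a ℤ.+ (+ 2) ℤ.* (+ c) ℤ.+ (+ 24) ℤ.* (+ d) ≡⟨ cong₂ (λ x y → + a ℤ.+ x ℤ.+ y) (sym (ℤ.pos-* 2 c)) (sym (ℤ.pos-* 24 d)) ⟩
    + (a + 2 * c + 24 * d)                       ≡⟨ cong +_ eq ⟩
    + (7 * b)                                    ≡⟨ ℤ.pos-* 7 b ⟩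
    (+ 7) ℤ.* (+ b)                              ∎

card-identity : ∀ {n m₁ m₂ m₃} → Related n m₁ m₂ m₃ →
  + card (H8^∇ n) ≡ (+ 7) ℤ.* (+ card (H8^∇ m₁)) ℤ.- (+ 2) ℤ.* (+ card (H8^∇ m₂)) ℤ.- (+ 24) ℤ.* (+ card (H8^∇ m₃))
card-identity {n} {m₁} {m₂} {m₃} R =
  integer-form (card (H8^∇ n)) (card (H8^∇ m₁)) (card (H8^∇ m₂)) (card (H8^∇ m₃)) (begin
    card (H8^∇ n) + 2 * card (H8^∇ m₂) + 24 * card (H8^∇ m₃)
      ≡⟨ cong₂ _+_ (cong₂ _+_ (card-H8^∇ n) (cong (2 *_) (card-H8^∇ m₂))) (cong (24 *_) (card-H8^∇ m₃)) ⟩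
    counts n one + 2 * counts m₂ one + 24 * counts m₃ one
      ≡⟨ Related.at R one ⟩
    7 * counts m₁ one
      ≡⟨ cong (7 *_) (sym (card-H8^∇ m₁)) ⟩
    7 * card (H8^∇ m₁) ∎)
  where open ≡-Reasoning

pushBit-true≡ : ∀ q → pushBit true q ≡ 1 + 2 * q
pushBit-true≡ = pushBit≡ true

P111Q : ∀ t α β → α + 2 ^ t * pushBit true (pushBit true (pushBit true β)) ≡ α + 7 * 2 ^ t + β * 2 ^ (t + 3)
P111Q t α β = begin
  α + 2 ^ t * pushBit true (pushBit true (pushBit true β))
    ≡⟨ cong (λ x → α + 2 ^ t * x) (trans (pushBit-true≡ (pushBit true (pushBit true β))) (cong (λ y → 1 + 2 * y)
         (trans (pushBit-true≡ (pushBit true β)) (cong (λ z → 1 + 2 * z) (pushBit-true≡ β))))) ⟩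
  α + 2 ^ t * (1 + 2 * (1 + 2 * (1 + 2 * β)))  ≡⟨ digits α (2 ^ t) β ⟩
  α + 7 * 2 ^ t + β * (2 ^ t * 2 ^ 3)          ≡⟨ cong (λ y → α + 7 * 2 ^ t + β * y) (sym (ℕ.^-distribˡ-+-* 2 t 3)) ⟩
  α + 7 * 2 ^ t + β * 2 ^ (t + 3)              ∎
  where
  open ≡-Reasoning
  digits : ∀ a p b → a + p * (1 + 2 * (1 + 2 * (1 + 2 * b))) ≡ a + 7 * p + b * (p * 8)
  digits = solve-∀

P11Q : ∀ t α β → α + 2 ^ t * pushBit true (pushBit true β) ≡ α + 3 * 2 ^ t + β * 2 ^ (t + 2)
P11Q t α β = begin
  α + 2 ^ t * pushBit true (pushBit true β)
    ≡⟨ cong (λ x → α + 2 ^ t * x) (trans (pushBit-true≡ (pushBit true β)) (cong (λ y → 1 + 2 * y) (pushBit-true≡ β))) ⟩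
  α + 2 ^ t * (1 + 2 * (1 + 2 * β))  ≡⟨ digits α (2 ^ t) β ⟩
  α + 3 * 2 ^ t + β * (2 ^ t * 2 ^ 2) ≡⟨ cong (λ y → α + 3 * 2 ^ t + β * y) (sym (ℕ.^-distribˡ-+-* 2 t 2)) ⟩
  α + 3 * 2 ^ t + β * 2 ^ (t + 2)     ∎
  where
  open ≡-Reasoning
  digits : ∀ a p b → a + p * (1 + 2 * (1 + 2 * b)) ≡ a + 3 * p + b * (p * 4)
  digits = solve-∀

P1Q : ∀ t α β → α + 2 ^ t * pushBit true β ≡ α + 2 ^ t + β * 2 ^ (t + 1)
P1Q t α β = begin
  α + 2 ^ t * pushBit true β        ≡⟨ cong (λ x → α + 2 ^ t * x) (pushBit-true≡ β) ⟩
  α + 2 ^ t * (1 + 2 * β)           ≡⟨ digits α (2 ^ t) β ⟩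
  α + 2 ^ t + β * (2 ^ t * 2 ^ 1)   ≡⟨ cong (λ y → α + 2 ^ t + β * y) (sym (ℕ.^-distribˡ-+-* 2 t 1)) ⟩
  α + 2 ^ t + β * 2 ^ (t + 1)       ∎
  where
  open ≡-Reasoning
  digits : ∀ a p b → a + p * (1 + 2 * b) ≡ a + p + b * (p * 2)
  digits = solve-∀

PQ : ∀ t α β → α + 2 ^ t * β ≡ α + β * 2 ^ t
PQ t α β = cong (λ x → α + x) (ℕ.*-comm (2 ^ t) β)

lemma13 : (t α β : ℕ) → α < 2 ^ t →
    + card (H8^∇ (α + 7 * 2 ^ t + β * 2 ^ (t + 3)))
      ≡ (+ 7) ℤ.* (+ card (H8^∇ (α + 3 * 2 ^ t + β * 2 ^ (t + 2))))
        ℤ.- (+ 2) ℤ.* (+ card (H8^∇ (α + 2 ^ t + β * 2 ^ (t + 1))))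
        ℤ.- (+ 24) ℤ.* (+ card (H8^∇ (α + β * 2 ^ t)))
lemma13 t α β α<2^t = card-identity
  (Related-cong (P111Q t α β) (P11Q t α β) (P1Q t α β) (PQ t α β)
    (Related-prefix (Related-base β) t α α<2^t))
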